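{- If $K$ is a class of structures and $K\leq_c PF$, then $K$ has the substructure property: no $\mathcal{A}_1\in K$ is isomorphic to a substructure of some $\mathcal{A}_2\in K$ unless $\mathcal{A}_1\cong\mathcal{A}_2$.
   Context: All structures are in a finite relational language and have universe a subset of $\omega$; a class of structures consists of structures in a single language and is closed under isomorphism (among structures with universe a subset of $\omega$). $D(\mathcal{A})$ denotes the atomic diagram (atomic sentences and negations of atomic sentences, with elements of $\omega$ as constants, true in $\mathcal{A}$). A computable transformation from $K$ to $K'$ is a c.e. set $\Phi$ of pairs $(\alpha,\varphi)$, $\alpha$ a finite subset of the atomic diagram of a finite structure in the language of $K$, $\varphi$ an atomic sentence or negated atomic sentence in the language of $K'$, such that for each $\mathcal{A}\in K$, $\{\varphi:\exists\alpha\subseteq D(\mathcal{A}),(\alpha,\varphi)\in\Phi\}=D(\mathcal{B})$ for some $\mathcal{B}\in K'$. A computable embedding is a computable transformation with $\mathcal{A}\cong\mathcal{A}'$ iff $\Phi(\mathcal{A})\cong\Phi(\mathcal{A}')$; $K\leq_c K'$ means a computable embedding exists. $PF$ is the class of finite prime fields (in a relational language); "$K\leq_c PF$" is equivalently $K$ reducible to any class computably equivalent to $PF$. -}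

module Defs where

open import Data.Nat using (ℕ; zero; suc; _+_; _*_; _^_; _<_)
open import Data.Nat.DivMod using (_%_)
open import Data.Nat.Primality using (Prime)
open import Data.Fin using (Fin; toℕ)
open import Data.Vec using (Vec; []; _∷_; map)
open import Data.Vec.Relation.Unary.All using (All)
import Data.Vec.Relation.Unary.All as VAll
import Data.Fin as Fin
import Data.Vec
import Data.Nat.DivMod
open import Level using (Lift)
import Level
open import Data.List using (List; []; _∷_)
open import Data.List.Relation.Unary.Any using () renaming (Any to AnyL)
import Data.List.Relation.Unary.All as LAll
open import Data.Product using (Σ; _×_; _,_; ∃; ∃-syntax)
open import Relation.Binary.PropositionalEquality using (_≡_; refl)
open import Relation.Nullary using (¬_)

-- A model of computation: primitive recursive functions.
-- A set S ⊆ ℕ is c.e. iff S = { x | ∃ y. f(x,y) = 0 } for some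
-- primitive recursive f (Kleene normal form).

data PR : ℕ → Set where
  pr-zero : ∀ {n} → PR n
  pr-succ : PR 1
  pr-proj : ∀ {n} → Fin n → PR n
  pr-comp : ∀ {m n} → PR m → Vec (PR n) m → PR n
  pr-rec  : ∀ {n} → PR n → PR (suc (suc n)) → PR (suc n)

mutual
  ⟦_⟧ : ∀ {n} → PR n → Vec ℕ n → ℕ
  ⟦ pr-zero ⟧ xs = 0
  ⟦ pr-succ ⟧ (x ∷ []) = suc x
  ⟦ pr-proj i ⟧ xs = Data.Vec.lookup xs i
  ⟦ pr-comp f gs ⟧ xs = ⟦ f ⟧ (⟦ gs ⟧* xs)
  ⟦ pr-rec g h ⟧ (zero ∷ xs) = ⟦ g ⟧ xs
  ⟦ pr-rec g h ⟧ (suc k ∷ xs) = ⟦ h ⟧ (k ∷ ⟦ pr-rec g h ⟧ (k ∷ xs) ∷ xs)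

  ⟦_⟧* : ∀ {m n} → Vec (PR n) m → Vec ℕ n → Vec ℕ m
  ⟦ [] ⟧* xs = []
  ⟦ g ∷ gs ⟧* xs = ⟦ g ⟧ xs ∷ ⟦ gs ⟧* xs

IsCE : (ℕ → Set) → Set
IsCE S = Σ (PR 2) λ f → ∀ x → (S x → ∃[ y ] (⟦ f ⟧ (x ∷ y ∷ []) ≡ 0))
                            × (∃[ y ] (⟦ f ⟧ (x ∷ y ∷ []) ≡ 0) → S x)

⟨_,_⟩ : ℕ → ℕ → ℕ
⟨ a , b ⟩ = 2 ^ a * (2 * b + 1)

record Language : Set where
  field
    nRel  : ℕ
    arity : Fin nRel → ℕ
open Language public

record Structure (L : Language) : Set₁ where
  field
    dom    : ℕ → Set
    rel    : (i : Fin (nRel L)) → Vec ℕ (arity L i) → Set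
    rel-dom : ∀ {i} {v} → rel i v → All dom v
open Structure public

record _≅_ {L : Language} (A B : Structure L) : Set where
  field
    to     : ℕ → ℕ
    from   : ℕ → ℕ
    to-dom   : ∀ {x} → dom A x → dom B (to x)
    from-dom : ∀ {y} → dom B y → dom A (from y)
    from-to  : ∀ {x} → dom A x → from (to x) ≡ x
    to-from  : ∀ {y} → dom B y → to (from y) ≡ y
    rel-to   : ∀ i (v : Vec ℕ (arity L i)) → All (dom A) v → rel A i v → rel B i (map to v)
    rel-from : ∀ i (v : Vec ℕ (arity L i)) → All (dom A) v → rel B i (map to v) → rel A i v

record _⊑_ {L : Language} (A B : Structure L) : Set where
  field
    dom-⊆  : ∀ {x} → dom A x → dom B x
    rel-to   : ∀ i (v : Vec ℕ (arity L i)) → All (dom A) v → rel A i v → rel B i v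
    rel-from : ∀ i (v : Vec ℕ (arity L i)) → All (dom A) v → rel B i v → rel A i v

Class : Language → Set₂
Class L = Structure L → Set₁

ClosedUnderIso : {L : Language} → Class L → Set₁
ClosedUnderIso {L} K = ∀ (A B : Structure L) → A ≅ B → K A → K B

data Atom (L : Language) : Set where
  eqA  : ℕ → ℕ → Atom L
  relA : (i : Fin (nRel L)) → Vec ℕ (arity L i) → Atom L

data Literal (L : Language) : Set where
  pos : Atom L → Literal L
  neg : Atom L → Literal L

-- D(A): the literals true in A (constants range over the universe of A)
D : {L : Language} → Structure L → Literal L → Set
D A (pos (eqA a b))  = dom A a × a ≡ b
D A (neg (eqA a b))  = dom A a × dom A b × ¬ (a ≡ b)
D A (pos (relA i v)) = rel A i v
D A (neg (relA i v)) = All (dom A) v × ¬ rel A i v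

codeVec : ∀ {k} → Vec ℕ k → ℕ
codeVec [] = 0
codeVec (x ∷ v) = suc ⟨ x , codeVec v ⟩

codeAtom : {L : Language} → Atom L → ℕ
codeAtom (eqA a b)  = ⟨ 0 , ⟨ a , b ⟩ ⟩
codeAtom (relA i v) = ⟨ 1 , ⟨ toℕ i , codeVec v ⟩ ⟩

codeLit : {L : Language} → Literal L → ℕ
codeLit (pos a) = ⟨ 0 , codeAtom a ⟩
codeLit (neg a) = ⟨ 1 , codeAtom a ⟩

codeLits : {L : Language} → List (Literal L) → ℕ
codeLits [] = 0
codeLits (φ ∷ α) = suc ⟨ codeLit φ , codeLits α ⟩

codePair : {L L′ : Language} → List (Literal L) → Literal L′ → ℕ
codePair α φ = ⟨ codeLits α , codeLit φ ⟩

-- Enumeration operators and computable embeddings.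
-- Φ is a set of (codes of) pairs (α , φ), α a finite set of L-literals,
-- φ an L′-literal.

apply : {L L′ : Language} → (ℕ → Set) → Structure L → Literal L′ → Set
apply {L} Φ A φ = Σ (List (Literal L)) λ α → LAll.All (D A) α × Φ (codePair α φ)

_=D_ : {L′ : Language} → (Literal L′ → Set) → Structure L′ → Set
S =D B = ∀ φ → (S φ → D B φ) × (D B φ → S φ)

IsTransformation : {L L′ : Language} → Class L → Class L′ → (ℕ → Set) → Set₁
IsTransformation {L} {L′} K K′ Φ =
  ∀ (A : Structure L) → K A → Σ (Structure L′) λ B → K′ B × (apply Φ A =D B)

IsEmbedding : {L L′ : Language} → Class L → (ℕ → Set) → Set₁
IsEmbedding {L} {L′} K Φ =
  ∀ (A A′ : Structure L) (B B′ : Structure L′) → K A → K A′ →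
    apply Φ A =D B → apply Φ A′ =D B′ →
    (A ≅ A′ → B ≅ B′) × (B ≅ B′ → A ≅ A′)

_≤c_ : {L L′ : Language} → Class L → Class L′ → Set₁
_≤c_ {L} {L′} K K′ =
  Σ (ℕ → Set) λ Φ → IsCE Φ × IsTransformation K K′ Φ × IsEmbedding {L} {L′} K Φ

-- Finite prime fields in the relational language {Add, Mul} (ternary
-- graphs of + and ·).

LF : Language
LF = record { nRel = 2 ; arity = λ _ → 3 }

-- the standard prime field ℤ/pℤ with p = suc q, universe {0,…,q}
Zp : ℕ → Structure LF
Zp q = record
  { dom = λ x → x < suc q
  ; rel = R
  ; rel-dom = R-dom }
  where
    R : Fin 2 → Vec ℕ 3 → Set
    R Fin.zero (x ∷ y ∷ z ∷ [])    = x < suc q × y < suc q × z ≡ (x + y) % suc q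
    R (Fin.suc _) (x ∷ y ∷ z ∷ []) = x < suc q × y < suc q × z ≡ (x * y) % suc q
    R-dom : ∀ {i} {v} → R i v → All (λ x → x < suc q) v
    R-dom {Fin.zero} {x ∷ y ∷ z ∷ []} (x< , y< , refl) =
      x< VAll.∷ y< VAll.∷ Data.Nat.DivMod.m%n<n (x + y) (suc q) VAll.∷ VAll.[]
    R-dom {Fin.suc _} {x ∷ y ∷ z ∷ []} (x< , y< , refl) =
      x< VAll.∷ y< VAll.∷ Data.Nat.DivMod.m%n<n (x * y) (suc q) VAll.∷ VAll.[]

PF : Class LF
PF B = Σ ℕ λ q → Prime (suc q) × Lift (Level.suc Level.zero) (B ≅ Zp q)

SubstructureProperty : {L : Language} → Class L → Set₁
SubstructureProperty {L} K =
  ∀ (A₁ A₂ : Structure L) → K A₁ → K A₂ →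
    (Σ (Structure L) λ A → A ⊑ A₂ × A₁ ≅ A) → A₁ ≅ A₂

module Submission where

-- Idea.  Let A₁ ≅ A ⊑ A₂ with A₁, A₂ ∈ K and let Φ witness K ≤c PF.  Since
-- D(A) ⊆ D(A₂) and an enumeration operator is monotone, Φ(A) ⊆ Φ(A₂), i.e.
-- the atomic diagram of the prime field B = Φ(A) is contained in that of
-- B₂ = Φ(A₂).  The key algebraic fact is that such a diagram inclusion
-- between finite prime fields is an isomorphism: transported to ℤ/q and
-- ℤ/p it is an injective map preserving the graphs of + and ·, hence sends
-- 0 ↦ 0 (additive idempotent) and 1 ↦ 1 (the only nonzero multiplicative
-- idempotent of a field), and therefore hits every k < p by induction.  So
-- B and B₂ have the same universe, and as the relations of B are decidable
-- the identity is an isomorphism.  As Φ reflects isomorphism, A ≅ A₂, and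
-- A₁ ≅ A₂ follows.

open import Defs
open import Data.Nat using (ℕ; zero; suc; _+_; _*_; _<_; NonZero; s≤s; z≤n)
import Data.Nat as ℕ
open import Data.Nat.Properties using (+-cancelˡ-≡; +-comm; <-trans; n<1+n)
open import Data.Nat.DivMod using (_%_; _/_; m≡m%n+[m/n]*n; m%n<n; m<n⇒m%n≡m)
open import Data.Nat.Divisibility using (_∣_; divides; n∣m⇒m%n≡0)
open import Data.Nat.Primality using (Prime; euclidsLemma; prime⇒nonTrivial)
import Data.Fin as Fin
open import Data.Vec using (Vec; []; _∷_; map)
open import Data.Vec.Relation.Unary.All using (All)
import Data.Vec.Relation.Unary.All as VAll
import Data.Vec.Relation.Unary.All.Properties as VAllP
import Data.Vec.Properties as VP
import Data.List.Relation.Unary.All as LAll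
open import Data.Product using (_×_; _,_; proj₁; proj₂; ∃-syntax)
open import Data.Sum using (inj₁; inj₂)
open import Data.Empty using (⊥-elim)
open import Level using (lift)
open import Relation.Binary.PropositionalEquality
  using (_≡_; refl; sym; trans; cong; cong₂; subst; _≢_; module ≡-Reasoning)
open import Relation.Nullary using (Dec; yes; no)
open import Relation.Nullary.Decidable using (_×-dec_)

module _ {L : Language} where

  ≅-trans : {A B C : Structure L} → A ≅ B → B ≅ C → A ≅ C
  ≅-trans {A} {B} {C} f g = record
    { to       = λ x → G.to (F.to x)
    ; from     = λ y → F.from (G.from y)
    ; to-dom   = λ a → G.to-dom (F.to-dom a)
    ; from-dom = λ c → F.from-dom (G.from-dom c)
    ; from-to  = λ a → trans (cong F.from (G.from-to (F.to-dom a))) (F.from-to a)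
    ; to-from  = λ c → trans (cong G.to (F.to-from (G.from-dom c))) (G.to-from c)
    ; rel-to   = λ i v av r → subst (rel C i) (sym (VP.map-∘ G.to F.to v))
        (G.rel-to i (map F.to v) (to-all av) (F.rel-to i v av r))
    ; rel-from = λ i v av r → F.rel-from i v av
        (G.rel-from i (map F.to v) (to-all av) (subst (rel C i) (VP.map-∘ G.to F.to v) r))
    }
    where
      module F = _≅_ f
      module G = _≅_ g
      to-all : ∀ {n} {v : Vec ℕ n} → All (dom A) v → All (dom B) (map F.to v)
      to-all av = VAllP.map⁺ (VAll.map F.to-dom av)

  -- It is the common shape of isomorphisms (in either
  -- direction) and diagram inclusions, and it is closed under composition.
  record _↪_ (A B : Structure L) : Set where
    field
      fun     : ℕ → ℕ
      fun-dom : ∀ {x} → dom A x → dom B (fun x)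
      fun-inj : ∀ {x y} → dom A x → dom A y → fun x ≡ fun y → x ≡ y
      fun-rel : ∀ i v → rel A i v → rel B i (map fun v)
  open _↪_ public

  ↪-∘ : {A B C : Structure L} → A ↪ B → B ↪ C → A ↪ C
  ↪-∘ {C = C} f g = record
    { fun     = λ x → fun g (fun f x)
    ; fun-dom = λ a → fun-dom g (fun-dom f a)
    ; fun-inj = λ a a′ e → fun-inj f a a′ (fun-inj g (fun-dom f a) (fun-dom f a′) e)
    ; fun-rel = λ i v r → subst (rel C i) (sym (VP.map-∘ (fun g) (fun f) v))
        (fun-rel g i (map (fun f) v) (fun-rel f i v r))
    }

  ≅⇒↪ : {A B : Structure L} → A ≅ B → A ↪ B
  ≅⇒↪ {A} f = record
    { fun     = F.to
    ; fun-dom = F.to-dom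
    ; fun-inj = λ a a′ e → trans (sym (F.from-to a)) (trans (cong F.from e) (F.from-to a′))
    ; fun-rel = λ i v r → F.rel-to i v (rel-dom A r) r
    }
    where module F = _≅_ f

  ≅⇒↩ : {A B : Structure L} → A ≅ B → B ↪ A
  ≅⇒↩ {A} {B} f = record
    { fun     = F.from
    ; fun-dom = F.from-dom
    ; fun-inj = λ b b′ e → trans (sym (F.to-from b)) (trans (cong F.to e) (F.to-from b′))
    ; fun-rel = λ i v r → F.rel-from i (map F.from v) (from-all (rel-dom B r))
        (subst (rel B i) (sym (to-from-all (rel-dom B r))) r)
    }
    where
      module F = _≅_ f
      from-all : ∀ {n} {v : Vec ℕ n} → All (dom B) v → All (dom A) (map F.from v)
      from-all bv = VAllP.map⁺ (VAll.map F.from-dom bv)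
      to-from-all : ∀ {n} {v : Vec ℕ n} → All (dom B) v → map F.to (map F.from v) ≡ v
      to-from-all VAll.[]       = refl
      to-from-all (b VAll.∷ bv) = cong₂ _∷_ (F.to-from b) (to-from-all bv)

  -- Diagram inclusion D(A) ⊆ D(B): A is a substructure of B in the sense
  -- the atomic diagram sees, which is what enumeration operators respect.
  _⊆D_ : Structure L → Structure L → Set
  A ⊆D B = ∀ φ → D A φ → D B φ

  -- The positive literals of D(A) record the universe and the relations of A.
  ⊆D-dom : {A B : Structure L} → A ⊆D B → ∀ {x} → dom A x → dom B x
  ⊆D-dom incl {x} a = proj₁ (incl (pos (eqA x x)) (a , refl))

  ⊆D-rel : {A B : Structure L} → A ⊆D B → ∀ i v → rel A i v → rel B i v
  ⊆D-rel incl i v = incl (pos (relA i v))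

  ⊑⇒⊆D : {A B : Structure L} → A ⊑ B → A ⊆D B
  ⊑⇒⊆D s (pos (eqA a b))      (a∈ , e)        = _⊑_.dom-⊆ s a∈ , e
  ⊑⇒⊆D s (neg (eqA a b))      (a∈ , b∈ , a≢b) = _⊑_.dom-⊆ s a∈ , _⊑_.dom-⊆ s b∈ , a≢b
  ⊑⇒⊆D {A} s (pos (relA i v)) r               = _⊑_.rel-to s i v (rel-dom A r) r
  ⊑⇒⊆D s (neg (relA i v))     (av , ¬r)       =
    VAll.map (_⊑_.dom-⊆ s) av , λ r → ¬r (_⊑_.rel-from s i v av r)

  ⊆D⇒↪ : {A B : Structure L} → A ⊆D B → A ↪ B
  ⊆D⇒↪ {B = B} incl = record
    { fun     = λ x → x
    ; fun-dom = ⊆D-dom incl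
    ; fun-inj = λ _ _ e → e
    ; fun-rel = λ i v r → subst (rel B i) (sym (VP.map-id v)) (⊆D-rel incl i v r)
    }

  ⊆D-full : {A B C : Structure L} → A ⊆D B → (g : B ≅ C) →
    (∀ {c} → dom C c → ∃[ x ] (dom A x × _≅_.to g x ≡ c)) →
    ∀ {y} → dom B y → dom A y
  ⊆D-full {A} incl g onto {y} b with onto (_≅_.to-dom g b)
  ... | x , a , e = subst (dom A) x≡y a
    where
      x≡y : x ≡ y
      x≡y = fun-inj (≅⇒↪ g) (⊆D-dom incl a) b e

  DecidableRelations : Structure L → Set
  DecidableRelations A = ∀ i v → All (dom A) v → Dec (rel A i v)

  ≅-decidable : {A B : Structure L} → A ≅ B → DecidableRelations B → DecidableRelations A
  ≅-decidable f decB i v av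
    with decB i (map (_≅_.to f) v) (VAllP.map⁺ (VAll.map (_≅_.to-dom f) av))
  ... | yes r = yes (_≅_.rel-from f i v av r)
  ... | no ¬r = no λ r → ¬r (_≅_.rel-to f i v av r)

  -- A diagram inclusion onto the whole universe is an isomorphism
  -- (decidability decides, for each tuple, which literal D(A) contains).
  ⊆D⇒≅ : {A B : Structure L} → DecidableRelations A → A ⊆D B →
    (∀ {y} → dom B y → dom A y) → A ≅ B
  ⊆D⇒≅ {A} {B} decA incl full = record
    { to       = λ x → x
    ; from     = λ x → x
    ; to-dom   = ⊆D-dom incl
    ; from-dom = full
    ; from-to  = λ _ → refl
    ; to-from  = λ _ → refl
    ; rel-to   = λ i v _ r → subst (rel B i) (sym (VP.map-id v)) (⊆D-rel incl i v r)
    ; rel-from = λ i v av r → reflect i v av (subst (rel B i) (VP.map-id v) r)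
    }
    where
      reflect : ∀ i v → All (dom A) v → rel B i v → rel A i v
      reflect i v av r with decA i v av
      ... | yes r′ = r′
      ... | no ¬r  = ⊥-elim (proj₂ (incl (neg (relA i v)) (av , ¬r)) r)

apply-mono : {L L′ : Language} (Φ : ℕ → Set) {A A₂ : Structure L} → A ⊆D A₂ →
  (φ : Literal L′) → apply Φ A φ → apply Φ A₂ φ
apply-mono Φ incl φ (α , α⊆D , αφ∈Φ) = α , LAll.map (λ {ψ} → incl ψ) α⊆D , αφ∈Φ

transformation-mono : {L L′ : Language} (Φ : ℕ → Set) {A A₂ : Structure L}
  {B B₂ : Structure L′} → apply Φ A =D B → apply Φ A₂ =D B₂ → A ⊆D A₂ → B ⊆D B₂
transformation-mono Φ ΦA=B ΦA₂=B₂ incl φ d =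
  proj₁ (ΦA₂=B₂ φ) (apply-mono Φ incl φ (proj₂ (ΦA=B φ) d))

module _ {n : ℕ} .{{_ : NonZero n}} where

  residue-eq : ∀ m r → m % n ≡ r → m ≡ r + (m / n) * n
  residue-eq m r e = trans (m≡m%n+[m/n]*n m n) (cong (_+ (m / n) * n) e)

  small-multiple : ∀ {m} → m < n → n ∣ m → m ≡ 0
  small-multiple {m} m<n n∣m = trans (sym (m<n⇒m%n≡m m<n)) (n∣m⇒m%n≡0 m n n∣m)

  additive-idempotent : ∀ {a} → a < n → (a + a) % n ≡ a → a ≡ 0
  additive-idempotent {a} a<n e =
    small-multiple a<n (divides ((a + a) / n) (+-cancelˡ-≡ a _ _ (residue-eq (a + a) a e)))

  -- In a prime field ℤ/n the only nonzero multiplicative idempotent is 1: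
  -- b² ≡ b means n ∣ (b - 1) · b, and n divides neither factor unless b = 1.
  multiplicative-idempotent : Prime n → ∀ {b} → b < n → b ≢ 0 → (b * b) % n ≡ b → b ≡ 1
  multiplicative-idempotent _ {zero} _ b≢0 _ = ⊥-elim (b≢0 refl)
  multiplicative-idempotent pn {suc c} b<n _ e
    with euclidsLemma c (suc c) pn
           (divides ((suc c * suc c) / n) (+-cancelˡ-≡ (suc c) _ _ (residue-eq _ _ e)))
  ... | inj₁ n∣c    = cong suc (small-multiple (<-trans (n<1+n c) b<n) n∣c)
  ... | inj₂ n∣1+c with small-multiple b<n n∣1+c
  ...   | ()

Zp-decidable : ∀ q → DecidableRelations (Zp q)
Zp-decidable q Fin.zero    (x ∷ y ∷ z ∷ []) _ =
  (x ℕ.<? suc q) ×-dec ((y ℕ.<? suc q) ×-dec (z ℕ.≟ (x + y) % suc q))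
Zp-decidable q (Fin.suc _) (x ∷ y ∷ z ∷ []) _ =
  (x ℕ.<? suc q) ×-dec ((y ℕ.<? suc q) ×-dec (z ℕ.≟ (x * y) % suc q))

-- An injective homomorphism from a nontrivial ℤ/(q+1) into a prime field
-- ℤ/(p+1) is onto: it fixes 0 and 1 and commutes with +, so its image
-- contains 0, 1, 1+1, ….
Zp-↪-onto : ∀ {q p} → 1 < suc q → Prime (suc p) → (h : Zp q ↪ Zp p) →
  ∀ k → k < suc p → ∃[ x ] (x < suc q × fun h x ≡ k)
Zp-↪-onto {q} {p} 1<q+1 pp h = onto
  where
    open ≡-Reasoning

    0<q+1 : 0 < suc q
    0<q+1 = s≤s z≤n

    h-+ : ∀ {x y} → x < suc q → y < suc q → fun h ((x + y) % suc q) ≡ (fun h x + fun h y) % suc p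
    h-+ {x} {y} x< y< = proj₂ (proj₂ (fun-rel h Fin.zero (x ∷ y ∷ (x + y) % suc q ∷ []) (x< , y< , refl)))

    h-* : ∀ {x y} → x < suc q → y < suc q → fun h ((x * y) % suc q) ≡ (fun h x * fun h y) % suc p
    h-* {x} {y} x< y< = proj₂ (proj₂ (fun-rel h (Fin.suc Fin.zero) (x ∷ y ∷ (x * y) % suc q ∷ []) (x< , y< , refl)))

    h-0 : fun h 0 ≡ 0
    h-0 = additive-idempotent (fun-dom h 0<q+1) (sym (h-+ 0<q+1 0<q+1))

    h-1 : fun h 1 ≡ 1
    h-1 = multiplicative-idempotent pp (fun-dom h 1<q+1)
      (λ h1≡0 → 1≢0 (fun-inj h 1<q+1 0<q+1 (trans h1≡0 (sym h-0))))
      (trans (sym (h-* 1<q+1 1<q+1)) (cong (fun h) (m<n⇒m%n≡m 1<q+1)))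
      where
        1≢0 : 1 ≢ 0
        1≢0 ()

    onto : ∀ k → k < suc p → ∃[ x ] (x < suc q × fun h x ≡ k)
    onto zero    _   = 0 , 0<q+1 , h-0
    onto (suc k) k+1< with onto k (<-trans (n<1+n k) k+1<)
    ... | x , x< , hx≡k = (x + 1) % suc q , m%n<n (x + 1) (suc q) , h[x+1]≡k+1
      where
        h[x+1]≡k+1 : fun h ((x + 1) % suc q) ≡ suc k
        h[x+1]≡k+1 = begin
          fun h ((x + 1) % suc q)     ≡⟨ h-+ x< 1<q+1 ⟩
          (fun h x + fun h 1) % suc p ≡⟨ cong₂ (λ a b → (a + b) % suc p) hx≡k h-1 ⟩
          (k + 1) % suc p             ≡⟨ cong (_% suc p) (+-comm k 1) ⟩
          suc k % suc p               ≡⟨ m<n⇒m%n≡m k+1< ⟩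
          suc k                       ∎

PF-⊆D⇒≅ : {B B₂ : Structure LF} → PF B → PF B₂ → B ⊆D B₂ → B ≅ B₂
PF-⊆D⇒≅ {B} (q , pq , lift f) (p , pp , lift g) incl =
  ⊆D⇒≅ (≅-decidable f (Zp-decidable q)) incl (⊆D-full incl g onto)
  where
    h : Zp q ↪ Zp p
    h = ↪-∘ (↪-∘ (≅⇒↩ f) (⊆D⇒↪ incl)) (≅⇒↪ g)

    1<q+1 : 1 < suc q
    1<q+1 = ℕ.nonTrivial⇒n>1 (suc q) {{prime⇒nonTrivial pq}}

    onto : ∀ {k} → k < suc p → ∃[ x ] (dom B x × _≅_.to g x ≡ k)
    onto {k} k< with Zp-↪-onto 1<q+1 pp h k k<
    ... | z , z< , hz≡k = _≅_.from f z , _≅_.from-dom f z< , hz≡k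

proposition3p3 : (L : Language) (K : Class L) → ClosedUnderIso K →
    K ≤c PF → SubstructureProperty K
proposition3p3 L K closed (Φ , _ , transform , embed) A₁ A₂ A₁∈K A₂∈K (A , A⊑A₂ , A₁≅A) =
  ≅-trans A₁≅A A≅A₂
  where
    A∈K : K A
    A∈K = closed A₁ A A₁≅A A₁∈K

    -- Φ(A) ⊆D Φ(A₂) are prime fields, hence isomorphic; Φ reflects ≅.
    A≅A₂ : A ≅ A₂
    A≅A₂ with transform A A∈K | transform A₂ A₂∈K
    ... | B , B∈PF , ΦA=B | B₂ , B₂∈PF , ΦA₂=B₂ =
      proj₂ (embed A A₂ B B₂ A∈K A₂∈K ΦA=B ΦA₂=B₂)
        (PF-⊆D⇒≅ B∈PF B₂∈PF (transformation-mono Φ ΦA=B ΦA₂=B₂ (⊑⇒⊆D A⊑A₂)))
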